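{- Let $A=\{a_1,a_2,a_3,a_4,a_5\}$ be a set of positive integers with $a_1<a_2<a_3<a_4<a_5$. Suppose that $a_i-a_{i-1}\ne 2a_1$ for exactly two indices $i\in\{2,3,4,5\}$ and $a_i-a_{i-1}=2a_1$ for the remaining two indices $i\in\{2,3,4,5\}$. Then $\left|4^{\wedge}_{\pm}A\right|\ge 26$.
   Context: For a positive integer $h$ and a finite set of integers $A=\{a_1,\ldots,a_k\}$ (distinct elements), the restricted $h$-fold signed sumset is $h^{\wedge}_{\pm}A=\left\{\sum_{i=1}^k\lambda_i a_i:\lambda_i\in\{ -1,0,1\},\ \sum_{i=1}^k|\lambda_i|=h\right\}$. -}

module Defs where

open import Data.Nat using (ℕ; zero; suc)
open import Data.Integer using (ℤ; +_; _+_; _-_; -_; _*_)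
import Data.Integer.Properties as ℤP
open import Data.List using (List; []; _∷_; map; concatMap; filter; length; deduplicate)
open import Data.Product using (_×_; _,_)
open import Relation.Nullary using (¬_)
open import Relation.Binary.PropositionalEquality using (_≡_)

-- Coefficient choices λ ∈ {-1,0,1}; we pair each partial sum with the
-- number of nonzero coefficients used so far (Σ |λ_i|).
-- signedSumsAll as : list of (Σ λ_i a_i , Σ |λ_i|) over all λ ∈ {-1,0,1}^k
signedSumsAll : List ℤ → List (ℤ × ℕ)
signedSumsAll [] = (+ 0 , 0) ∷ []
signedSumsAll (a ∷ as) =
  concatMap (λ { (s , c) → (s , c) ∷ (s + a , suc c) ∷ (s - a , suc c) ∷ [] })
            (signedSumsAll as)

-- The restricted h-fold signed sumset h^∧_± A, as a list (possibly with repeats),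
-- for A given by the list of its (distinct) elements.
restrictedSignedSumsetList : ℕ → List ℤ → List ℤ
restrictedSignedSumsetList h as =
  map (λ { (s , c) → s })
      (filter (λ { (s , c) → c Data.Nat.≟ h }) (signedSumsAll as))

card-restrictedSignedSumset : ℕ → List ℤ → ℕ
card-restrictedSignedSumset h as =
  length (deduplicate ℤP._≟_ (restrictedSignedSumsetList h as))

countEq : ℤ → List ℤ → ℕ
countEq x xs = length (filter (λ y → y ℤP.≟ x) xs)

-- Write the gaps of A as 2a₁ (twice) and two other values p, q ≠ 2a₁. Every element of A, and
-- hence every element of 4^∧_± A, is then an integer linear form in (a₁, p, q). For each of the
-- six arrangements of the gaps, split according to the sign of p − 2a₁ (and, in one arrangement,
-- of q − 2a₁). On each piece we exhibit 26 forms of the formal sumset such that consecutive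
-- differences have non-negative, not all zero, coefficients in variables that are positive on
-- that piece (such as a₁, p − 2a₁, q). Their values strictly increase, so the sumset has at
-- least 26 elements.
module Submission where

open import Defs
open import Data.Nat as ℕ using (ℕ; _≥_; suc; z≤n; s≤s)
open import Data.Integer using (ℤ; +_; _<_; _-_; _*_)
open import Data.List using (List; []; _∷_)
open import Relation.Binary.PropositionalEquality using (_≡_)

import Data.Nat.Properties as ℕ
open import Data.Integer as ℤ using (0ℤ; _+_; -_; _≤_; _≟_; _≤?_; _<?_)
open import Data.Integer.Properties as ℤ using (module ≤-Reasoning)
open import Data.Integer.Tactic.RingSolver using (solve-∀)
open import Data.List using (length; map; concatMap; filter; deduplicate; _++_)
open import Data.List.Scans.Base using (scanl)
import Data.List.Properties as List
open import Data.List.Membership.Propositional using (_∈_)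
open import Data.List.Membership.Propositional.Properties
  using (∈-∃++; ∈-++⁻; ∈-++⁺ˡ; ∈-++⁺ʳ; ∈-deduplicate⁺; ∈-map⁺)
open import Data.List.Relation.Binary.Subset.Propositional using (_⊆_)
open import Data.List.Relation.Unary.Any using (here; there)
import Data.List.Relation.Unary.All as All
import Data.List.Relation.Unary.All.Properties as All
open import Data.List.Relation.Unary.AllPairs as AllPairs using (_∷_)
open import Data.List.Relation.Unary.Linked as Linked using (Linked; linked?)
import Data.List.Relation.Unary.Linked.Properties as Linked
open import Data.List.Relation.Unary.Unique.Propositional using (Unique)
open import Data.Vec using (Vec; []; _∷_; zipWith; replicate)
import Data.Vec.Properties as Vec
open import Data.Vec.Relation.Unary.All using (All; []; _∷_; all?)
open import Data.Vec.Relation.Unary.Any using (Any; here; there; any?)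
open import Data.Product using (_×_; _,_; proj₁; map₁)
open import Data.Sum using (_⊎_; inj₁; inj₂)
open import Data.Bool using (true; false)
open import Function using (_∘_)
open import Relation.Binary.Core using (Rel)
open import Relation.Binary.Definitions using (tri<; tri≈; tri>)
import Relation.Binary.Definitions as B
open import Relation.Binary.PropositionalEquality
  using (_≢_; refl; sym; trans; cong; cong₂; subst; module ≡-Reasoning)
open import Relation.Nullary using (yes; no; contradiction; _×-dec_)
open import Relation.Nullary.Decidable using (True; toWitness)
import Relation.Unary as U

private
  variable
    n : ℕ

Unique⊆⇒length≤ : ∀ {a} {A : Set a} {xs ys : List A} → Unique xs → xs ⊆ ys → length xs ℕ.≤ length ys
Unique⊆⇒length≤ {xs = []} _ _ = z≤n
Unique⊆⇒length≤ {xs = x ∷ xs} (x∉xs ∷ xs!) xs⊆ys with ∈-∃++ (xs⊆ys (here refl))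
... | ys₁ , ys₂ , refl = begin
  suc (length xs)           ≤⟨ s≤s (Unique⊆⇒length≤ xs! xs⊆ys₁++ys₂) ⟩
  suc (length (ys₁ ++ ys₂)) ≡⟨ List.length-++-sucʳ ys₁ x ys₂ ⟨
  length (ys₁ ++ x ∷ ys₂)   ∎
  where
  open ℕ.≤-Reasoning
  xs⊆ys₁++ys₂ : xs ⊆ ys₁ ++ ys₂
  xs⊆ys₁++ys₂ z∈xs with ∈-++⁻ ys₁ (xs⊆ys (there z∈xs))
  ... | inj₁ z∈ys₁         = ∈-++⁺ˡ z∈ys₁
  ... | inj₂ (here refl)   = contradiction refl (All.lookup x∉xs z∈xs)
  ... | inj₂ (there z∈ys₂) = ∈-++⁺ʳ ys₁ z∈ys₂

increasing⊆⇒length≤deduplicate : ∀ {xs ys : List ℤ} → Linked _<_ xs → xs ⊆ ys →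
  length xs ℕ.≤ length (deduplicate _≟_ ys)
increasing⊆⇒length≤deduplicate xs< xs⊆ys =
  Unique⊆⇒length≤ (AllPairs.map ℤ.<⇒≢ (Linked.Linked⇒AllPairs ℤ.<-trans xs<)) (∈-deduplicate⁺ _≟_ ∘ xs⊆ys)

i+[j-i]≡j : ∀ i j → i + (j - i) ≡ j
i+[j-i]≡j = solve-∀

i<j⇒0<j-i : ∀ {i j} → i < j → 0ℤ < j - i
i<j⇒0<j-i {i} {j} i<j = begin-strict
  0ℤ     ≡⟨ ℤ.+-inverseʳ i ⟨
  i - i  <⟨ ℤ.+-monoˡ-< (- i) i<j ⟩
  j - i  ∎
  where open ≤-Reasoning

0<j-i⇒i<j : ∀ {i j} → 0ℤ < j - i → i < j
0<j-i⇒i<j {i} {j} 0<j-i = begin-strict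
  i            ≡⟨ ℤ.+-identityʳ i ⟨
  i + 0ℤ       <⟨ ℤ.+-monoʳ-< i 0<j-i ⟩
  i + (j - i)  ≡⟨ i+[j-i]≡j i j ⟩
  j            ∎
  where open ≤-Reasoning

≢⇒<⊎> : ∀ {i j} → i ≢ j → i < j ⊎ j < i
≢⇒<⊎> {i} {j} i≢j with ℤ.<-cmp i j
... | tri< i<j _ _ = inj₁ i<j
... | tri≈ _ i≡j _ = contradiction i≡j i≢j
... | tri> _ _ j<i = inj₂ j<i

0≤i∧0<j⇒0≤i*j : ∀ {i j} → 0ℤ ≤ i → 0ℤ < j → 0ℤ ≤ i * j
0≤i∧0<j⇒0≤i*j {j = j} 0≤i 0<j = ℤ.*-monoʳ-≤-nonNeg j {{ℤ.nonNegative (ℤ.<⇒≤ 0<j)}} 0≤i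

0<i∧0<j⇒0<i*j : ∀ {i j} → 0ℤ < i → 0ℤ < j → 0ℤ < i * j
0<i∧0<j⇒0<i*j {j = j} 0<i 0<j = ℤ.*-monoʳ-<-pos j {{ℤ.positive 0<j}} 0<i

Form : ℕ → Set
Form = Vec ℤ

infixl 6 _⊕_ _⊖_
infix 7 _·_

_⊕_ _⊖_ : Form n → Form n → Form n
_⊕_ = zipWith _+_
_⊖_ = zipWith _-_

𝟎 : Form n
𝟎 = replicate _ 0ℤ

_·_ : Form n → Vec ℤ n → ℤ
[] · [] = 0ℤ
(a ∷ f) · (x ∷ g) = a * x + f · g

·-distribʳ-⊕ : ∀ (f f′ : Form n) g → (f ⊕ f′) · g ≡ f · g + f′ · g
·-distribʳ-⊕ [] [] [] = refl
·-distribʳ-⊕ (a ∷ f) (a′ ∷ f′) (x ∷ g) rewrite ·-distribʳ-⊕ f f′ g = interchange a a′ x (f · g) (f′ · g)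
  where
  interchange : ∀ a a′ x s s′ → (a + a′) * x + (s + s′) ≡ (a * x + s) + (a′ * x + s′)
  interchange = solve-∀

·-distribʳ-⊖ : ∀ (f f′ : Form n) g → (f ⊖ f′) · g ≡ f · g - f′ · g
·-distribʳ-⊖ [] [] [] = refl
·-distribʳ-⊖ (a ∷ f) (a′ ∷ f′) (x ∷ g) rewrite ·-distribʳ-⊖ f f′ g = interchange a a′ x (f · g) (f′ · g)
  where
  interchange : ∀ a a′ x s s′ → (a - a′) * x + (s - s′) ≡ (a * x + s) - (a′ * x + s′)
  interchange = solve-∀

·-zeroˡ : ∀ (g : Vec ℤ n) → 𝟎 · g ≡ 0ℤ
·-zeroˡ [] = refl
·-zeroˡ (x ∷ g) = trans (ℤ.+-identityˡ (𝟎 · g)) (·-zeroˡ g)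

Positive : Form n → Set
Positive f = All (0ℤ ≤_) f × Any (0ℤ <_) f

positive? : U.Decidable (Positive {n})
positive? f = all? (0ℤ ≤?_) f ×-dec any? (0ℤ <?_) f

·-nonNeg : ∀ {f g : Vec ℤ n} → All (0ℤ ≤_) f → All (0ℤ <_) g → 0ℤ ≤ f · g
·-nonNeg [] [] = ℤ.≤-refl
·-nonNeg (0≤a ∷ 0≤f) (0<x ∷ 0<g) = ℤ.+-mono-≤ (0≤i∧0<j⇒0≤i*j 0≤a 0<x) (·-nonNeg 0≤f 0<g)

·-pos : ∀ {f g : Vec ℤ n} → Positive f → All (0ℤ <_) g → 0ℤ < f · g
·-pos (0≤a ∷ 0≤f , here 0<a)  (0<x ∷ 0<g) = ℤ.+-mono-<-≤ (0<i∧0<j⇒0<i*j 0<a 0<x) (·-nonNeg 0≤f 0<g)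
·-pos (0≤a ∷ 0≤f , there pos) (0<x ∷ 0<g) = ℤ.+-mono-≤-< (0≤i∧0<j⇒0≤i*j 0≤a 0<x) (·-pos (0≤f , pos) 0<g)

signedExtensions : Form n → Form n × ℕ → List (Form n × ℕ)
signedExtensions f (s , c) = (s , c) ∷ (s ⊕ f , suc c) ∷ (s ⊖ f , suc c) ∷ []

formalSignedSums : List (Form n) → List (Form n × ℕ)
formalSignedSums [] = (𝟎 , 0) ∷ []
formalSignedSums (f ∷ fs) = concatMap (signedExtensions f) (formalSignedSums fs)

formalRestrictedSums : ℕ → List (Form n) → List (Form n)
formalRestrictedSums h fs = map proj₁ (filter (λ (s , c) → c ℕ.≟ h) (formalSignedSums fs))

module _ (g : Vec ℤ n) where

  private
    evaluate : Form n × ℕ → ℤ × ℕ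
    evaluate = map₁ (_· g)

  signedSumsAll-· : ∀ fs → map evaluate (formalSignedSums fs) ≡ signedSumsAll (map (_· g) fs)
  signedSumsAll-· [] = cong (λ z → (z , 0) ∷ []) (·-zeroˡ g)
  signedSumsAll-· (f ∷ fs) =
    trans (map-concatMap (formalSignedSums fs)) (cong (concatMap extendℤ) (signedSumsAll-· fs))
    where
    extendℤ : ℤ × ℕ → List (ℤ × ℕ)
    extendℤ (s , c) = (s , c) ∷ (s + f · g , suc c) ∷ (s - f · g , suc c) ∷ []

    map-concatMap : ∀ L → map evaluate (concatMap (signedExtensions f) L) ≡ concatMap extendℤ (map evaluate L)
    map-concatMap [] = refl
    map-concatMap ((s , c) ∷ L)
      rewrite ·-distribʳ-⊕ s f g | ·-distribʳ-⊖ s f g | map-concatMap L = refl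

  restrictedSignedSumsetList-· : ∀ h fs →
    restrictedSignedSumsetList h (map (_· g) fs) ≡ map (_· g) (formalRestrictedSums h fs)
  restrictedSignedSumsetList-· h fs =
    trans (cong (λ L → map proj₁ (filter (λ (s , c) → c ℕ.≟ h) L)) (sym (signedSumsAll-· fs)))
          (map-filter (formalSignedSums fs))
    where
    map-filter : ∀ L → map proj₁ (filter (λ (s , c) → c ℕ.≟ h) (map evaluate L))
                     ≡ map (_· g) (map proj₁ (filter (λ (s , c) → c ℕ.≟ h) L))
    map-filter [] = refl
    -- c ℕ.≟ h reduces to a test on c ℕ.≡ᵇ h, which is therefore the term to abstract
    map-filter ((s , c) ∷ L) with c ℕ.≡ᵇ h
    ... | true  = cong (s · g ∷_) (map-filter L)
    ... | false = map-filter L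

-- P, multiplied by the positive scale, written in coordinates that are all positive;
-- express is the corresponding change of coefficients.
record PositiveCoordinates (P : Vec ℤ n) : Set where
  field
    scale     : ℤ
    coords    : Vec ℤ n
    express   : Form n → Form n
    0<scale   : 0ℤ < scale
    0<coords  : All (0ℤ <_) coords
    express-· : ∀ f → scale * (f · P) ≡ express f · coords

module Certified {P : Vec ℤ n} (C : PositiveCoordinates P) where
  open PositiveCoordinates C
  open import Data.List.Membership.DecPropositional (Vec.≡-dec {n = n} _≟_) using (_∈?_)

  Positive-express⇒0<· : ∀ {f} → Positive (express f) → 0ℤ < f · P
  Positive-express⇒0<· {f} pos =
    ℤ.*-cancelˡ-<-nonNeg scale {{ℤ.nonNegative (ℤ.<⇒≤ 0<scale)}} (begin-strict
      scale * 0ℤ         ≡⟨ ℤ.*-zeroʳ scale ⟩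
      0ℤ                 <⟨ ·-pos pos 0<coords ⟩
      express f · coords ≡⟨ express-· f ⟨
      scale * (f · P)    ∎)
    where open ≤-Reasoning

  _≺_ : Rel (Form n) _
  u ≺ v = Positive (express (v ⊖ u))

  _≺?_ : B.Decidable _≺_
  u ≺? v = positive? (express (v ⊖ u))

  ≺⇒<· : ∀ {u v} → u ≺ v → u · P < v · P
  ≺⇒<· {u} {v} u≺v = 0<j-i⇒i<j (subst (0ℤ <_) (·-distribʳ-⊖ v u P) (Positive-express⇒0<· u≺v))

  length≤card : ∀ {h fs chain} → Linked _≺_ chain → All.All (_∈ formalRestrictedSums h fs) chain →
    length chain ℕ.≤ card-restrictedSignedSumset h (map (_· P) fs)
  length≤card {h} {fs} {chain} chain≺ chain⊆ = begin
    length chain                                   ≡⟨ List.length-map (_· P) chain ⟨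
    length (map (_· P) chain)                      ≤⟨ increasing⊆⇒length≤deduplicate values< values⊆ ⟩
    length (deduplicate _≟_ (map (_· P) sums))     ≡⟨ cong (length ∘ deduplicate _≟_) (restrictedSignedSumsetList-· P h fs) ⟨
    card-restrictedSignedSumset h (map (_· P) fs)  ∎
    where
    open ℕ.≤-Reasoning
    sums : List (Form n)
    sums = formalRestrictedSums h fs
    values< : Linked _<_ (map (_· P) chain)
    values< = Linked.map⁺ (Linked.map ≺⇒<· chain≺)
    values⊆ : map (_· P) chain ⊆ map (_· P) sums
    values⊆ = All.lookup (All.map⁺ (All.map (∈-map⁺ (_· P)) chain⊆))

  certify : ∀ h fs chain →
    {True (linked? _≺?_ chain)} → {True (All.all? (_∈? formalRestrictedSums h fs) chain)} →
    length chain ℕ.≤ card-restrictedSignedSumset h (map (_· P) fs)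
  certify h fs chain {chain≺} {chain⊆} = length≤card {h} {fs} (toWitness chain≺) (toWitness chain⊆)

differences : ℤ → List ℤ → List ℤ
differences x [] = []
differences x (y ∷ ys) = (y - x) ∷ differences y ys

scanl-differences : ∀ x ys → scanl _+_ x (differences x ys) ≡ x ∷ ys
scanl-differences x [] = refl
scanl-differences x (y ∷ ys) rewrite i+[j-i]≡j x y = cong (x ∷_) (scanl-differences y ys)

map-scanl : ∀ {a b} {A : Set a} {B : Set b} (φ : A → B) {_∙_ : A → A → A} {_∘_ : B → B → B} →
  (∀ u v → φ (u ∙ v) ≡ φ u ∘ φ v) → ∀ e xs → map φ (scanl _∙_ e xs) ≡ scanl _∘_ (φ e) (map φ xs)
map-scanl φ φ-hom e [] = refl
map-scanl φ {_∙_} {_∘_} φ-hom e (x ∷ xs) =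
  cong (φ e ∷_) (trans (map-scanl φ φ-hom (e ∙ x) xs) (cong (λ z → scanl _∘_ z (map φ xs)) (φ-hom e x)))

pattern ⟨_,_,_⟩ a b c = a ∷ b ∷ c ∷ []

data Gap : Set where
  doubled other₁ other₂ : Gap

gapValue : ℤ → ℤ → ℤ → Gap → ℤ
gapValue x p q doubled = + 2 * x
gapValue x p q other₁  = p
gapValue x p q other₂  = q

gapForm : Gap → Form 3
gapForm doubled = ⟨ + 2 , 0ℤ , 0ℤ ⟩
gapForm other₁  = ⟨ 0ℤ , + 1 , 0ℤ ⟩
gapForm other₂  = ⟨ 0ℤ , 0ℤ , + 1 ⟩

gapForm-· : ∀ x p q γ → gapForm γ · ⟨ x , p , q ⟩ ≡ gapValue x p q γ
gapForm-· x p q doubled = doubled-· x p q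
  where
  doubled-· : ∀ x p q → + 2 * x + (0ℤ * p + (0ℤ * q + 0ℤ)) ≡ + 2 * x
  doubled-· = solve-∀
gapForm-· x p q other₁ = other₁-· x p q
  where
  other₁-· : ∀ x p q → 0ℤ * x + (+ 1 * p + (0ℤ * q + 0ℤ)) ≡ p
  other₁-· = solve-∀
gapForm-· x p q other₂ = other₂-· x p q
  where
  other₂-· : ∀ x p q → 0ℤ * x + (0ℤ * p + (+ 1 * q + 0ℤ)) ≡ q
  other₂-· = solve-∀

-- d marks a gap equal to 2a₁, o one of the other two gaps
data Arrangement : Set where
  ddoo dodo dood oddo odod oodd : Arrangement

gaps : Arrangement → List Gap
gaps ddoo = doubled ∷ doubled ∷ other₁  ∷ other₂  ∷ []
gaps dodo = doubled ∷ other₁  ∷ doubled ∷ other₂  ∷ []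
gaps dood = doubled ∷ other₁  ∷ other₂  ∷ doubled ∷ []
gaps oddo = other₁  ∷ doubled ∷ doubled ∷ other₂  ∷ []
gaps odod = other₁  ∷ doubled ∷ other₂  ∷ doubled ∷ []
gaps oodd = other₁  ∷ other₂  ∷ doubled ∷ doubled ∷ []

elementForms : Arrangement → List (Form 3)
elementForms π = scanl _⊕_ ⟨ + 1 , 0ℤ , 0ℤ ⟩ (map gapForm (gaps π))

elementForms-· : ∀ π x p q →
  map (_· ⟨ x , p , q ⟩) (elementForms π) ≡ scanl _+_ x (map (gapValue x p q) (gaps π))
elementForms-· π x p q = begin
  map (_· P) (elementForms π)                        ≡⟨ map-scanl (_· P) (λ f f′ → ·-distribʳ-⊕ f f′ P) _ _ ⟩
  scanl _+_ (e₁ · P) (map (_· P) (map gapForm γs))   ≡⟨ cong (scanl _+_ _) (List.map-∘ γs) ⟨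
  scanl _+_ (e₁ · P) (map (λ γ → gapForm γ · P) γs)  ≡⟨ cong₂ (scanl _+_) (e₁-· x p q) (List.map-cong (gapForm-· x p q) γs) ⟩
  scanl _+_ x (map (gapValue x p q) γs)              ∎
  where
  open ≡-Reasoning
  P e₁ : Vec ℤ 3
  P = ⟨ x , p , q ⟩
  e₁ = ⟨ + 1 , 0ℤ , 0ℤ ⟩
  γs : List Gap
  γs = gaps π
  e₁-· : ∀ x p q → + 1 * x + (0ℤ * p + (0ℤ * q + 0ℤ)) ≡ x
  e₁-· = solve-∀

data CountEqView (t : ℤ) : List ℤ → ℕ → Set where
  []   : CountEqView t [] 0
  hit  : ∀ {gs k} → CountEqView t gs k → CountEqView t (t ∷ gs) (suc k)
  miss : ∀ {g gs k} → g ≢ t → CountEqView t gs k → CountEqView t (g ∷ gs) k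

countEq-view : ∀ t gs → CountEqView t gs (countEq t gs)
countEq-view t [] = []
countEq-view t (g ∷ gs) with g ≟ t
... | yes refl = hit (countEq-view t gs)
... | no g≢t   = miss g≢t (countEq-view t gs)

data TwoDoubledGaps (x : ℤ) (gs : List ℤ) : Set where
  arranged : ∀ π {p q} → 0ℤ < p → 0ℤ < q → p ≢ + 2 * x → q ≢ + 2 * x →
             gs ≡ map (gapValue x p q) (gaps π) → TwoDoubledGaps x gs

classify : ∀ {x g₂ g₃ g₄ g₅} → 0ℤ < g₂ → 0ℤ < g₃ → 0ℤ < g₄ → 0ℤ < g₅ →
  CountEqView (+ 2 * x) (g₂ ∷ g₃ ∷ g₄ ∷ g₅ ∷ []) 2 → TwoDoubledGaps x (g₂ ∷ g₃ ∷ g₄ ∷ g₅ ∷ [])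
classify _   _   0<p 0<q (hit (hit (miss p≢ (miss q≢ [])))) = arranged ddoo 0<p 0<q p≢ q≢ refl
classify _   0<p _   0<q (hit (miss p≢ (hit (miss q≢ [])))) = arranged dodo 0<p 0<q p≢ q≢ refl
classify _   0<p 0<q _   (hit (miss p≢ (miss q≢ (hit [])))) = arranged dood 0<p 0<q p≢ q≢ refl
classify 0<p _   _   0<q (miss p≢ (hit (hit (miss q≢ [])))) = arranged oddo 0<p 0<q p≢ q≢ refl
classify 0<p _   0<q _   (miss p≢ (hit (miss q≢ (hit [])))) = arranged odod 0<p 0<q p≢ q≢ refl
classify 0<p 0<q _   _   (miss p≢ (miss q≢ (hit (hit [])))) = arranged oodd 0<p 0<q p≢ q≢ refl
classify _   _   _   _   (miss _ (miss _ (miss _ (hit ()))))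
classify _   _   _   _   (miss _ (miss _ (miss _ (miss _ ()))))

module _ {x p q : ℤ} where

  p-above : 0ℤ < x → + 2 * x < p → 0ℤ < q → PositiveCoordinates ⟨ x , p , q ⟩
  p-above 0<x 2x<p 0<q = record
    { scale     = + 1
    ; coords    = ⟨ x , p - + 2 * x , q ⟩
    ; express   = λ { ⟨ a , b , c ⟩ → ⟨ a + + 2 * b , b , c ⟩ }
    ; 0<scale   = ℤ.+<+ ℕ.z<s
    ; 0<coords  = 0<x ∷ i<j⇒0<j-i 2x<p ∷ 0<q ∷ []
    ; express-· = λ { ⟨ a , b , c ⟩ → identity a b c x p q }
    }
    where
    identity : ∀ a b c x p q → + 1 * (a * x + (b * p + (c * q + 0ℤ)))
                             ≡ (a + + 2 * b) * x + (b * (p - + 2 * x) + (c * q + 0ℤ))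
    identity = solve-∀

  p-below : 0ℤ < p → p < + 2 * x → 0ℤ < q → PositiveCoordinates ⟨ x , p , q ⟩
  p-below 0<p p<2x 0<q = record
    { scale     = + 2
    ; coords    = ⟨ + 2 * x - p , p , q ⟩
    ; express   = λ { ⟨ a , b , c ⟩ → ⟨ a , a + + 2 * b , + 2 * c ⟩ }
    ; 0<scale   = ℤ.+<+ ℕ.z<s
    ; 0<coords  = i<j⇒0<j-i p<2x ∷ 0<p ∷ 0<q ∷ []
    ; express-· = λ { ⟨ a , b , c ⟩ → identity a b c x p q }
    }
    where
    identity : ∀ a b c x p q → + 2 * (a * x + (b * p + (c * q + 0ℤ)))
                             ≡ a * (+ 2 * x - p) + ((a + + 2 * b) * p + (+ 2 * c * q + 0ℤ))
    identity = solve-∀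

  p-above-q-above : 0ℤ < x → + 2 * x < p → + 2 * x < q → PositiveCoordinates ⟨ x , p , q ⟩
  p-above-q-above 0<x 2x<p 2x<q = record
    { scale     = + 1
    ; coords    = ⟨ x , p - + 2 * x , q - + 2 * x ⟩
    ; express   = λ { ⟨ a , b , c ⟩ → ⟨ a + + 2 * b + + 2 * c , b , c ⟩ }
    ; 0<scale   = ℤ.+<+ ℕ.z<s
    ; 0<coords  = 0<x ∷ i<j⇒0<j-i 2x<p ∷ i<j⇒0<j-i 2x<q ∷ []
    ; express-· = λ { ⟨ a , b , c ⟩ → identity a b c x p q }
    }
    where
    identity : ∀ a b c x p q → + 1 * (a * x + (b * p + (c * q + 0ℤ)))
                             ≡ (a + + 2 * b + + 2 * c) * x + (b * (p - + 2 * x) + (c * (q - + 2 * x) + 0ℤ))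
    identity = solve-∀

  p-above-q-below : + 2 * x < p → q < + 2 * x → 0ℤ < q → PositiveCoordinates ⟨ x , p , q ⟩
  p-above-q-below 2x<p q<2x 0<q = record
    { scale     = + 2
    ; coords    = ⟨ p - + 2 * x , + 2 * x - q , q ⟩
    ; express   = λ { ⟨ a , b , c ⟩ → ⟨ + 2 * b , a + + 2 * b , a + + 2 * b + + 2 * c ⟩ }
    ; 0<scale   = ℤ.+<+ ℕ.z<s
    ; 0<coords  = i<j⇒0<j-i 2x<p ∷ i<j⇒0<j-i q<2x ∷ 0<q ∷ []
    ; express-· = λ { ⟨ a , b , c ⟩ → identity a b c x p q }
    }
    where
    identity : ∀ a b c x p q → + 2 * (a * x + (b * p + (c * q + 0ℤ)))
                             ≡ + 2 * b * (p - + 2 * x) + ((a + + 2 * b) * (+ 2 * x - q) + ((a + + 2 * b + + 2 * c) * q + 0ℤ))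
    identity = solve-∀

-- Each chain lists forms of the formal 4-fold sumset, increasing on the region in its name;
-- certify checks both properties by evaluation.
module Chains where
  open import Agda.Builtin.FromNat using (Number; fromNat)
  open import Agda.Builtin.FromNeg using (Negative; fromNeg)
  -- tt must be in scope to discharge the literals' Constraint instances
  open import Data.Unit using (tt)
  import Data.Nat.Literals as ℕLiterals
  import Data.Integer.Literals as ℤLiterals

  instance
    ℕ-number : Number ℕ
    ℕ-number = ℕLiterals.number
    ℤ-number : Number ℤ
    ℤ-number = ℤLiterals.number
    ℤ-negative : Negative ℤ
    ℤ-negative = ℤLiterals.negative

  ddoo-p-below : List (Form 3)
  ddoo-p-below =
      ⟨ -18 , -2 , -1 ⟩ ∷ ⟨ -16 , -2 , -1 ⟩ ∷ ⟨ -14 , -2 , -1 ⟩ ∷ ⟨ -14 , -1 , -1 ⟩ ∷ ⟨ -12 , -2 , -1 ⟩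
    ∷ ⟨ -12 , -1 , -1 ⟩ ∷ ⟨ -8 , -2 , -1 ⟩ ∷ ⟨ -8 , -1 , -1 ⟩ ∷ ⟨ -8 , 0 , -1 ⟩ ∷ ⟨ -6 , -1 , -1 ⟩
    ∷ ⟨ -6 , 0 , -1 ⟩ ∷ ⟨ -4 , -1 , -1 ⟩ ∷ ⟨ -4 , 0 , -1 ⟩ ∷ ⟨ -2 , -1 , -1 ⟩ ∷ ⟨ -2 , 0 , -1 ⟩
    ∷ ⟨ 2 , -1 , -1 ⟩ ∷ ⟨ 2 , 0 , -1 ⟩ ∷ ⟨ 2 , 1 , 0 ⟩ ∷ ⟨ 2 , 1 , 1 ⟩ ∷ ⟨ 2 , 2 , 1 ⟩
    ∷ ⟨ 4 , 1 , 1 ⟩ ∷ ⟨ 4 , 2 , 1 ⟩ ∷ ⟨ 6 , 1 , 1 ⟩ ∷ ⟨ 6 , 2 , 1 ⟩ ∷ ⟨ 8 , 1 , 1 ⟩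
    ∷ ⟨ 8 , 2 , 1 ⟩ ∷ []

  ddoo-p-above-q-above : List (Form 3)
  ddoo-p-above-q-above =
      ⟨ -18 , -2 , -1 ⟩ ∷ ⟨ -16 , -2 , -1 ⟩ ∷ ⟨ -14 , -2 , -1 ⟩ ∷ ⟨ -12 , -2 , -1 ⟩ ∷ ⟨ -14 , -1 , -1 ⟩
    ∷ ⟨ -12 , -1 , -1 ⟩ ∷ ⟨ -8 , -1 , -1 ⟩ ∷ ⟨ -6 , -1 , -1 ⟩ ∷ ⟨ -8 , 0 , -1 ⟩ ∷ ⟨ -6 , 0 , -1 ⟩
    ∷ ⟨ -4 , 0 , -1 ⟩ ∷ ⟨ -2 , 0 , -1 ⟩ ∷ ⟨ -6 , 0 , 1 ⟩ ∷ ⟨ -4 , 0 , 1 ⟩ ∷ ⟨ -2 , 0 , 1 ⟩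
    ∷ ⟨ -4 , 1 , 1 ⟩ ∷ ⟨ -2 , 1 , 1 ⟩ ∷ ⟨ 2 , 1 , 1 ⟩ ∷ ⟨ 4 , 1 , 1 ⟩ ∷ ⟨ 2 , 2 , 1 ⟩
    ∷ ⟨ 4 , 2 , 1 ⟩ ∷ ⟨ 6 , 2 , 1 ⟩ ∷ ⟨ 8 , 2 , 1 ⟩ ∷ ⟨ 12 , 2 , 1 ⟩ ∷ ⟨ 14 , 2 , 1 ⟩
    ∷ ⟨ 16 , 2 , 1 ⟩ ∷ []

  ddoo-p-above-q-below : List (Form 3)
  ddoo-p-above-q-below =
      ⟨ -18 , -2 , -1 ⟩ ∷ ⟨ -16 , -2 , -1 ⟩ ∷ ⟨ -14 , -2 , -1 ⟩ ∷ ⟨ -12 , -2 , -1 ⟩ ∷ ⟨ -14 , -1 , -1 ⟩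
    ∷ ⟨ -14 , -1 , 0 ⟩ ∷ ⟨ -12 , -1 , -1 ⟩ ∷ ⟨ -12 , -1 , 0 ⟩ ∷ ⟨ -8 , -1 , -1 ⟩ ∷ ⟨ -8 , -1 , 0 ⟩
    ∷ ⟨ -6 , -1 , -1 ⟩ ∷ ⟨ -6 , -1 , 0 ⟩ ∷ ⟨ -4 , -1 , -1 ⟩ ∷ ⟨ -4 , -1 , 0 ⟩ ∷ ⟨ -2 , -1 , -1 ⟩
    ∷ ⟨ -4 , 0 , -1 ⟩ ∷ ⟨ -4 , 0 , 1 ⟩ ∷ ⟨ -4 , 1 , 0 ⟩ ∷ ⟨ -4 , 1 , 1 ⟩ ∷ ⟨ -2 , 1 , 0 ⟩
    ∷ ⟨ -2 , 1 , 1 ⟩ ∷ ⟨ 2 , 1 , 0 ⟩ ∷ ⟨ 2 , 1 , 1 ⟩ ∷ ⟨ 4 , 1 , 0 ⟩ ∷ ⟨ 4 , 1 , 1 ⟩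
    ∷ ⟨ 6 , 1 , 0 ⟩ ∷ []

  dodo-p-above : List (Form 3)
  dodo-p-above =
      ⟨ -16 , -3 , -1 ⟩ ∷ ⟨ -14 , -3 , -1 ⟩ ∷ ⟨ -12 , -3 , -1 ⟩ ∷ ⟨ -14 , -2 , -1 ⟩ ∷ ⟨ -12 , -2 , -1 ⟩
    ∷ ⟨ -10 , -2 , -1 ⟩ ∷ ⟨ -8 , -2 , -1 ⟩ ∷ ⟨ -10 , -1 , -1 ⟩ ∷ ⟨ -8 , -1 , -1 ⟩ ∷ ⟨ -6 , -1 , -1 ⟩
    ∷ ⟨ -4 , -1 , -1 ⟩ ∷ ⟨ -6 , 0 , -1 ⟩ ∷ ⟨ -6 , 0 , 0 ⟩ ∷ ⟨ -4 , 0 , 0 ⟩ ∷ ⟨ -4 , 0 , 1 ⟩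
    ∷ ⟨ -2 , 0 , 1 ⟩ ∷ ⟨ 0 , 0 , 1 ⟩ ∷ ⟨ 2 , 0 , 1 ⟩ ∷ ⟨ 0 , 1 , 1 ⟩ ∷ ⟨ 2 , 1 , 1 ⟩
    ∷ ⟨ 4 , 1 , 1 ⟩ ∷ ⟨ 6 , 1 , 1 ⟩ ∷ ⟨ 4 , 2 , 1 ⟩ ∷ ⟨ 6 , 2 , 1 ⟩ ∷ ⟨ 8 , 2 , 1 ⟩
    ∷ ⟨ 10 , 2 , 1 ⟩ ∷ []

  dodo-p-below : List (Form 3)
  dodo-p-below =
      ⟨ -16 , -3 , -1 ⟩ ∷ ⟨ -14 , -3 , -1 ⟩ ∷ ⟨ -14 , -2 , -1 ⟩ ∷ ⟨ -12 , -3 , -1 ⟩ ∷ ⟨ -12 , -2 , -1 ⟩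
    ∷ ⟨ -10 , -3 , -1 ⟩ ∷ ⟨ -10 , -2 , -1 ⟩ ∷ ⟨ -10 , -1 , -1 ⟩ ∷ ⟨ -8 , -2 , -1 ⟩ ∷ ⟨ -8 , -1 , -1 ⟩
    ∷ ⟨ -6 , -2 , -1 ⟩ ∷ ⟨ -6 , -1 , -1 ⟩ ∷ ⟨ -6 , 0 , -1 ⟩ ∷ ⟨ -4 , -1 , -1 ⟩ ∷ ⟨ -4 , 0 , -1 ⟩
    ∷ ⟨ -4 , 0 , 0 ⟩ ∷ ⟨ -4 , 0 , 1 ⟩ ∷ ⟨ -2 , -1 , 1 ⟩ ∷ ⟨ -2 , 0 , 1 ⟩ ∷ ⟨ 0 , -1 , 1 ⟩
    ∷ ⟨ 0 , 0 , 1 ⟩ ∷ ⟨ 0 , 1 , 1 ⟩ ∷ ⟨ 2 , 0 , 1 ⟩ ∷ ⟨ 2 , 1 , 1 ⟩ ∷ ⟨ 4 , 0 , 1 ⟩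
    ∷ ⟨ 4 , 1 , 1 ⟩ ∷ []

  dood-p-above : List (Form 3)
  dood-p-above =
      ⟨ -14 , -3 , -2 ⟩ ∷ ⟨ -12 , -3 , -2 ⟩ ∷ ⟨ -10 , -3 , -2 ⟩ ∷ ⟨ -12 , -2 , -2 ⟩ ∷ ⟨ -12 , -2 , -1 ⟩
    ∷ ⟨ -10 , -2 , -1 ⟩ ∷ ⟨ -8 , -2 , -1 ⟩ ∷ ⟨ -6 , -2 , -1 ⟩ ∷ ⟨ -4 , -2 , -1 ⟩ ∷ ⟨ -2 , -2 , -1 ⟩
    ∷ ⟨ -4 , -1 , 0 ⟩ ∷ ⟨ -6 , 0 , 0 ⟩ ∷ ⟨ -4 , 0 , 0 ⟩ ∷ ⟨ -4 , 0 , 1 ⟩ ∷ ⟨ -2 , 0 , 1 ⟩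
    ∷ ⟨ 0 , 0 , 1 ⟩ ∷ ⟨ 2 , 0 , 1 ⟩ ∷ ⟨ 4 , 0 , 1 ⟩ ∷ ⟨ 6 , 0 , 1 ⟩ ∷ ⟨ 2 , 2 , 1 ⟩
    ∷ ⟨ 4 , 2 , 1 ⟩ ∷ ⟨ 6 , 2 , 1 ⟩ ∷ ⟨ 8 , 2 , 1 ⟩ ∷ ⟨ 10 , 2 , 1 ⟩ ∷ ⟨ 10 , 2 , 2 ⟩
    ∷ ⟨ 8 , 3 , 2 ⟩ ∷ []

  dood-p-below : List (Form 3)
  dood-p-below =
      ⟨ -14 , -3 , -2 ⟩ ∷ ⟨ -12 , -3 , -2 ⟩ ∷ ⟨ -12 , -2 , -2 ⟩ ∷ ⟨ -10 , -3 , -2 ⟩ ∷ ⟨ -10 , -2 , -2 ⟩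
    ∷ ⟨ -8 , -3 , -2 ⟩ ∷ ⟨ -8 , -1 , -2 ⟩ ∷ ⟨ -6 , -2 , -2 ⟩ ∷ ⟨ -6 , -1 , -2 ⟩ ∷ ⟨ -4 , -2 , -2 ⟩
    ∷ ⟨ -4 , -2 , -1 ⟩ ∷ ⟨ -4 , 0 , -1 ⟩ ∷ ⟨ -4 , 0 , 0 ⟩ ∷ ⟨ -2 , -1 , 0 ⟩ ∷ ⟨ -2 , 0 , 0 ⟩
    ∷ ⟨ -2 , 1 , 0 ⟩ ∷ ⟨ 0 , 0 , 0 ⟩ ∷ ⟨ 0 , 1 , 0 ⟩ ∷ ⟨ 2 , 0 , 0 ⟩ ∷ ⟨ 2 , 1 , 0 ⟩
    ∷ ⟨ 4 , 0 , 0 ⟩ ∷ ⟨ 4 , 0 , 1 ⟩ ∷ ⟨ 4 , 2 , 1 ⟩ ∷ ⟨ 4 , 2 , 2 ⟩ ∷ ⟨ 6 , 1 , 2 ⟩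
    ∷ ⟨ 6 , 2 , 2 ⟩ ∷ []

  oddo-p-above : List (Form 3)
  oddo-p-above =
      ⟨ -14 , -4 , -1 ⟩ ∷ ⟨ -14 , -3 , -1 ⟩ ∷ ⟨ -12 , -3 , -1 ⟩ ∷ ⟨ -10 , -3 , -1 ⟩ ∷ ⟨ -12 , -2 , -1 ⟩
    ∷ ⟨ -8 , -2 , -1 ⟩ ∷ ⟨ -10 , -1 , -1 ⟩ ∷ ⟨ -8 , -1 , -1 ⟩ ∷ ⟨ -8 , -1 , 0 ⟩ ∷ ⟨ -6 , -1 , 0 ⟩
    ∷ ⟨ -4 , -1 , 0 ⟩ ∷ ⟨ -2 , -1 , 0 ⟩ ∷ ⟨ 0 , -1 , 0 ⟩ ∷ ⟨ 2 , -1 , 0 ⟩ ∷ ⟨ -2 , 1 , 0 ⟩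
    ∷ ⟨ 0 , 1 , 0 ⟩ ∷ ⟨ 0 , 1 , 1 ⟩ ∷ ⟨ 2 , 1 , 1 ⟩ ∷ ⟨ 4 , 1 , 1 ⟩ ∷ ⟨ 6 , 1 , 1 ⟩
    ∷ ⟨ 8 , 1 , 1 ⟩ ∷ ⟨ 10 , 1 , 1 ⟩ ∷ ⟨ 8 , 2 , 1 ⟩ ∷ ⟨ 8 , 3 , 1 ⟩ ∷ ⟨ 10 , 3 , 1 ⟩
    ∷ ⟨ 12 , 3 , 1 ⟩ ∷ []

  oddo-p-below : List (Form 3)
  oddo-p-below =
      ⟨ -14 , -4 , -1 ⟩ ∷ ⟨ -14 , -3 , -1 ⟩ ∷ ⟨ -12 , -3 , -1 ⟩ ∷ ⟨ -12 , -2 , -1 ⟩ ∷ ⟨ -10 , -3 , -1 ⟩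
    ∷ ⟨ -10 , -1 , -1 ⟩ ∷ ⟨ -8 , -2 , -1 ⟩ ∷ ⟨ -8 , -1 , -1 ⟩ ∷ ⟨ -6 , -1 , -1 ⟩ ∷ ⟨ -6 , 0 , -1 ⟩
    ∷ ⟨ -4 , -1 , -1 ⟩ ∷ ⟨ -2 , -1 , -1 ⟩ ∷ ⟨ -2 , 0 , -1 ⟩ ∷ ⟨ -2 , 1 , -1 ⟩ ∷ ⟨ 0 , 1 , -1 ⟩
    ∷ ⟨ 2 , 0 , -1 ⟩ ∷ ⟨ 2 , 1 , -1 ⟩ ∷ ⟨ 2 , 1 , 0 ⟩ ∷ ⟨ 2 , 1 , 1 ⟩ ∷ ⟨ 4 , 1 , 1 ⟩
    ∷ ⟨ 4 , 2 , 1 ⟩ ∷ ⟨ 6 , 1 , 1 ⟩ ∷ ⟨ 8 , 1 , 1 ⟩ ∷ ⟨ 8 , 2 , 1 ⟩ ∷ ⟨ 8 , 3 , 1 ⟩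
    ∷ ⟨ 10 , 3 , 1 ⟩ ∷ []

  odod-p-above : List (Form 3)
  odod-p-above =
      ⟨ -12 , -4 , -2 ⟩ ∷ ⟨ -12 , -3 , -2 ⟩ ∷ ⟨ -10 , -3 , -2 ⟩ ∷ ⟨ -8 , -3 , -2 ⟩ ∷ ⟨ -10 , -2 , -2 ⟩
    ∷ ⟨ -6 , -2 , -2 ⟩ ∷ ⟨ -8 , -1 , -2 ⟩ ∷ ⟨ -8 , -1 , -1 ⟩ ∷ ⟨ -6 , -1 , -1 ⟩ ∷ ⟨ -6 , -1 , 0 ⟩
    ∷ ⟨ -4 , -1 , 0 ⟩ ∷ ⟨ -2 , -1 , 0 ⟩ ∷ ⟨ 0 , -1 , 0 ⟩ ∷ ⟨ 2 , -1 , 0 ⟩ ∷ ⟨ 0 , 0 , 0 ⟩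
    ∷ ⟨ -2 , 1 , 0 ⟩ ∷ ⟨ 0 , 1 , 0 ⟩ ∷ ⟨ 0 , 1 , 1 ⟩ ∷ ⟨ 2 , 1 , 1 ⟩ ∷ ⟨ 4 , 1 , 1 ⟩
    ∷ ⟨ 4 , 1 , 2 ⟩ ∷ ⟨ 6 , 1 , 2 ⟩ ∷ ⟨ 8 , 1 , 2 ⟩ ∷ ⟨ 6 , 2 , 2 ⟩ ∷ ⟨ 10 , 2 , 2 ⟩
    ∷ ⟨ 8 , 3 , 2 ⟩ ∷ []

  odod-p-below : List (Form 3)
  odod-p-below =
      ⟨ -12 , -4 , -2 ⟩ ∷ ⟨ -12 , -3 , -2 ⟩ ∷ ⟨ -10 , -3 , -2 ⟩ ∷ ⟨ -10 , -2 , -2 ⟩ ∷ ⟨ -8 , -3 , -2 ⟩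
    ∷ ⟨ -8 , -1 , -2 ⟩ ∷ ⟨ -6 , -2 , -2 ⟩ ∷ ⟨ -6 , -1 , -2 ⟩ ∷ ⟨ -6 , -1 , -1 ⟩ ∷ ⟨ -6 , -1 , 0 ⟩
    ∷ ⟨ -4 , -1 , 0 ⟩ ∷ ⟨ -4 , 0 , 0 ⟩ ∷ ⟨ -2 , -1 , 0 ⟩ ∷ ⟨ -2 , 1 , 0 ⟩ ∷ ⟨ 0 , 0 , 0 ⟩
    ∷ ⟨ 0 , 1 , 0 ⟩ ∷ ⟨ 2 , 1 , 0 ⟩ ∷ ⟨ 2 , 2 , 0 ⟩ ∷ ⟨ 4 , 1 , 0 ⟩ ∷ ⟨ 4 , 1 , 1 ⟩
    ∷ ⟨ 4 , 1 , 2 ⟩ ∷ ⟨ 6 , 1 , 2 ⟩ ∷ ⟨ 6 , 2 , 2 ⟩ ∷ ⟨ 8 , 1 , 2 ⟩ ∷ ⟨ 8 , 3 , 2 ⟩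
    ∷ ⟨ 10 , 2 , 2 ⟩ ∷ []

  oodd-p-above : List (Form 3)
  oodd-p-above =
      ⟨ -10 , -4 , -3 ⟩ ∷ ⟨ -10 , -3 , -3 ⟩ ∷ ⟨ -10 , -3 , -2 ⟩ ∷ ⟨ -8 , -3 , -2 ⟩ ∷ ⟨ -6 , -3 , -2 ⟩
    ∷ ⟨ -4 , -3 , -2 ⟩ ∷ ⟨ -8 , -1 , -2 ⟩ ∷ ⟨ -8 , -1 , -1 ⟩ ∷ ⟨ -6 , -1 , -1 ⟩ ∷ ⟨ -6 , -1 , 0 ⟩
    ∷ ⟨ -4 , -1 , 0 ⟩ ∷ ⟨ -2 , -1 , 0 ⟩ ∷ ⟨ 0 , -1 , 0 ⟩ ∷ ⟨ -4 , 1 , 0 ⟩ ∷ ⟨ -2 , 1 , 0 ⟩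
    ∷ ⟨ -2 , 1 , 1 ⟩ ∷ ⟨ 0 , 1 , 1 ⟩ ∷ ⟨ 2 , 1 , 1 ⟩ ∷ ⟨ 2 , 1 , 2 ⟩ ∷ ⟨ 4 , 1 , 2 ⟩
    ∷ ⟨ 6 , 1 , 2 ⟩ ∷ ⟨ 8 , 1 , 2 ⟩ ∷ ⟨ 4 , 3 , 2 ⟩ ∷ ⟨ 6 , 3 , 2 ⟩ ∷ ⟨ 8 , 3 , 2 ⟩
    ∷ ⟨ 8 , 3 , 3 ⟩ ∷ []

  oodd-p-below : List (Form 3)
  oodd-p-below =
      ⟨ -10 , -4 , -3 ⟩ ∷ ⟨ -10 , -3 , -3 ⟩ ∷ ⟨ -8 , -3 , -3 ⟩ ∷ ⟨ -8 , -2 , -3 ⟩ ∷ ⟨ -8 , -1 , -2 ⟩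
    ∷ ⟨ -8 , -1 , -1 ⟩ ∷ ⟨ -6 , -1 , -1 ⟩ ∷ ⟨ -6 , 0 , -1 ⟩ ∷ ⟨ -4 , -1 , -1 ⟩ ∷ ⟨ -2 , -1 , -1 ⟩
    ∷ ⟨ -2 , 0 , -1 ⟩ ∷ ⟨ 0 , -1 , -1 ⟩ ∷ ⟨ 0 , -1 , 0 ⟩ ∷ ⟨ 0 , 1 , 0 ⟩ ∷ ⟨ 0 , 1 , 1 ⟩
    ∷ ⟨ 0 , 2 , 1 ⟩ ∷ ⟨ 2 , 1 , 1 ⟩ ∷ ⟨ 4 , 1 , 1 ⟩ ∷ ⟨ 4 , 2 , 1 ⟩ ∷ ⟨ 6 , 1 , 1 ⟩
    ∷ ⟨ 6 , 1 , 2 ⟩ ∷ ⟨ 6 , 3 , 2 ⟩ ∷ ⟨ 8 , 3 , 2 ⟩ ∷ ⟨ 8 , 3 , 3 ⟩ ∷ ⟨ 10 , 3 , 3 ⟩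
    ∷ ⟨ 10 , 4 , 3 ⟩ ∷ []

open Chains
open Certified using (certify)

26≤card-elementForms : ∀ π {x p q} → 0ℤ < x → 0ℤ < p → 0ℤ < q → p ≢ + 2 * x → q ≢ + 2 * x →
  26 ℕ.≤ card-restrictedSignedSumset 4 (map (_· ⟨ x , p , q ⟩) (elementForms π))
-- for ddoo no single chain covers all of 2a₁ < p, so q is compared with 2a₁ too
26≤card-elementForms ddoo 0<x 0<p 0<q p≢2x q≢2x with ≢⇒<⊎> p≢2x | ≢⇒<⊎> q≢2x
... | inj₁ p<2x | _         = certify (p-below 0<p p<2x 0<q) 4 (elementForms ddoo) ddoo-p-below
... | inj₂ 2x<p | inj₁ q<2x = certify (p-above-q-below 2x<p q<2x 0<q) 4 (elementForms ddoo) ddoo-p-above-q-below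
... | inj₂ 2x<p | inj₂ 2x<q = certify (p-above-q-above 0<x 2x<p 2x<q) 4 (elementForms ddoo) ddoo-p-above-q-above
26≤card-elementForms dodo 0<x 0<p 0<q p≢2x _ with ≢⇒<⊎> p≢2x
... | inj₁ p<2x = certify (p-below 0<p p<2x 0<q) 4 (elementForms dodo) dodo-p-below
... | inj₂ 2x<p = certify (p-above 0<x 2x<p 0<q) 4 (elementForms dodo) dodo-p-above
26≤card-elementForms dood 0<x 0<p 0<q p≢2x _ with ≢⇒<⊎> p≢2x
... | inj₁ p<2x = certify (p-below 0<p p<2x 0<q) 4 (elementForms dood) dood-p-below
... | inj₂ 2x<p = certify (p-above 0<x 2x<p 0<q) 4 (elementForms dood) dood-p-above
26≤card-elementForms oddo 0<x 0<p 0<q p≢2x _ with ≢⇒<⊎> p≢2x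
... | inj₁ p<2x = certify (p-below 0<p p<2x 0<q) 4 (elementForms oddo) oddo-p-below
... | inj₂ 2x<p = certify (p-above 0<x 2x<p 0<q) 4 (elementForms oddo) oddo-p-above
26≤card-elementForms odod 0<x 0<p 0<q p≢2x _ with ≢⇒<⊎> p≢2x
... | inj₁ p<2x = certify (p-below 0<p p<2x 0<q) 4 (elementForms odod) odod-p-below
... | inj₂ 2x<p = certify (p-above 0<x 2x<p 0<q) 4 (elementForms odod) odod-p-above
26≤card-elementForms oodd 0<x 0<p 0<q p≢2x _ with ≢⇒<⊎> p≢2x
... | inj₁ p<2x = certify (p-below 0<p p<2x 0<q) 4 (elementForms oodd) oodd-p-below
... | inj₂ 2x<p = certify (p-above 0<x 2x<p 0<q) 4 (elementForms oodd) oodd-p-above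

lemma3p4 : (a₁ a₂ a₃ a₄ a₅ : ℤ) →
    + 0 < a₁ → a₁ < a₂ → a₂ < a₃ → a₃ < a₄ → a₄ < a₅ →
    countEq (+ 2 * a₁) ((a₂ - a₁) ∷ (a₃ - a₂) ∷ (a₄ - a₃) ∷ (a₅ - a₄) ∷ []) ≡ 2 →
    card-restrictedSignedSumset 4 (a₁ ∷ a₂ ∷ a₃ ∷ a₄ ∷ a₅ ∷ []) ≥ 26
lemma3p4 a₁ a₂ a₃ a₄ a₅ 0<a₁ a₁<a₂ a₂<a₃ a₃<a₄ a₄<a₅ two-doubled
  with classify (i<j⇒0<j-i a₁<a₂) (i<j⇒0<j-i a₂<a₃) (i<j⇒0<j-i a₃<a₄) (i<j⇒0<j-i a₄<a₅)
                (subst (CountEqView _ _) two-doubled (countEq-view _ _))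
... | arranged π {p} {q} 0<p 0<q p≢2x q≢2x gaps≡ =
  subst (λ A → 26 ℕ.≤ card-restrictedSignedSumset 4 A) elements≡ (26≤card-elementForms π 0<a₁ 0<p 0<q p≢2x q≢2x)
  where
  open ≡-Reasoning
  elements≡ : map (_· ⟨ a₁ , p , q ⟩) (elementForms π) ≡ a₁ ∷ a₂ ∷ a₃ ∷ a₄ ∷ a₅ ∷ []
  elements≡ = begin
    map (_· ⟨ a₁ , p , q ⟩) (elementForms π)                ≡⟨ elementForms-· π a₁ p q ⟩
    scanl _+_ a₁ (map (gapValue a₁ p q) (gaps π))           ≡⟨ cong (scanl _+_ a₁) gaps≡ ⟨
    scanl _+_ a₁ (differences a₁ (a₂ ∷ a₃ ∷ a₄ ∷ a₅ ∷ [])) ≡⟨ scanl-differences a₁ _ ⟩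
    a₁ ∷ a₂ ∷ a₃ ∷ a₄ ∷ a₅ ∷ []                              ∎
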